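{- For each category $\mathcal{C}$ satisfying the coproduct assumption below there is a functor (indexed category) $\mathrm{Pred}\colon\mathcal{C}^{\mathrm{op}}\to\mathbf{EMon}$.
   Context: A predicate on $X$ is $p\colon X\to X+X$ with $\nabla\circ p=\mathrm{id}$; $\mathrm{Pred}(X)$ carries an effect algebra structure ($1=\kappa_1$, $0=\kappa_2$, $p^\perp=[\kappa_2,\kappa_1]\circ p$, partial sum $p\boxplus q=(\nabla+\mathrm{id})\circ b$ for a bound $b\colon X\to(X+X)+X$ with $[\mathrm{id},\kappa_2]\circ b=p$, $[[\kappa_2,\kappa_1],\kappa_2]\circ b=q$) and a multiplication $p\cdot q=[p,\kappa_2]\circ q$ that is bihomomorphic, making it an effect monoid. Substitution along $f\colon X\to Y$: $f^*(q)$ is the unique map with $\nabla\circ f^*(q)=\mathrm{id}$, $(f+f)\circ f^*(q)=q\circ f$. Coproduct assumption: (i) squares (E), (K), (K+) formed with maps $f+\mathrm{id}$, $\mathrm{id}+g$, $f+g$ and coprojections $\kappa_1$ are pullbacks; (ii) $[\mathrm{id},\kappa_2],[[\kappa_2,\kappa_1],\kappa_2]\colon(X+X)+X\rightrightarrows X+X$ are jointly monic; (iii) squares (D): $f+f$ over $f$ with verticals $\nabla$, and (D+): $(f+f)+f$ over $f+f$ with verticals $\nabla+\mathrm{id}$, are pullbacks. $\mathbf{EMon}$ is the category of effect monoids. Here $\boxplus$ denotes the partial sum operation. -}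

module Defs where

open import Level using (Level; _⊔_) renaming (suc to lsuc)
open import Data.Product using (Σ; Σ-syntax; _×_; _,_; proj₁; proj₂)
open import Relation.Binary.Structures using (IsEquivalence)
open import Relation.Binary.Bundles using (Setoid)
import Relation.Binary.Reasoning.Setoid as SetoidR

record Category (o ℓ e : Level) : Set (lsuc (o ⊔ ℓ ⊔ e)) where
  infixr 9 _∘_
  infix  4 _≈_
  infixr 0 _⇒_
  field
    Obj      : Set o
    _⇒_      : Obj → Obj → Set ℓ
    _≈_      : ∀ {A B} → (A ⇒ B) → (A ⇒ B) → Set e
    id       : ∀ {A} → A ⇒ A
    _∘_      : ∀ {A B C} → (B ⇒ C) → (A ⇒ B) → (A ⇒ C)
    equiv    : ∀ {A B} → IsEquivalence (_≈_ {A} {B})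
    assoc    : ∀ {A B C D} {f : A ⇒ B} {g : B ⇒ C} {h : C ⇒ D} →
               (h ∘ g) ∘ f ≈ h ∘ (g ∘ f)
    identityˡ : ∀ {A B} {f : A ⇒ B} → id ∘ f ≈ f
    identityʳ : ∀ {A B} {f : A ⇒ B} → f ∘ id ≈ f
    ∘-resp-≈ : ∀ {A B C} {f f' : B ⇒ C} {g g' : A ⇒ B} →
               f ≈ f' → g ≈ g' → f ∘ g ≈ f' ∘ g'

  hom-setoid : Obj → Obj → Setoid ℓ e
  hom-setoid A B = record { Carrier = A ⇒ B ; _≈_ = _≈_ ; isEquivalence = equiv }

record Coproducts {o ℓ e} (C : Category o ℓ e) : Set (o ⊔ ℓ ⊔ e) where
  open Category C
  infixr 6 _+_
  field
    _+_     : Obj → Obj → Obj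
    κ₁      : ∀ {A B} → A ⇒ A + B
    κ₂      : ∀ {A B} → B ⇒ A + B
    [_,_]   : ∀ {A B Z} → A ⇒ Z → B ⇒ Z → A + B ⇒ Z
    inject₁ : ∀ {A B Z} {f : A ⇒ Z} {g : B ⇒ Z} → [ f , g ] ∘ κ₁ ≈ f
    inject₂ : ∀ {A B Z} {f : A ⇒ Z} {g : B ⇒ Z} → [ f , g ] ∘ κ₂ ≈ g
    unique  : ∀ {A B Z} {f : A ⇒ Z} {g : B ⇒ Z} {h : A + B ⇒ Z} →
              h ∘ κ₁ ≈ f → h ∘ κ₂ ≈ g → h ≈ [ f , g ]

  infixr 7 _+₁_
  _+₁_ : ∀ {A B A' B'} → A ⇒ A' → B ⇒ B' → A + B ⇒ A' + B'
  f +₁ g = [ κ₁ ∘ f , κ₂ ∘ g ]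

  ∇ : ∀ {A} → A + A ⇒ A
  ∇ = [ id , id ]

record IsPullback {o ℓ e} (C : Category o ℓ e) {P A B Cc : Category.Obj C}
    (p₁ : Category._⇒_ C P A) (p₂ : Category._⇒_ C P B)
    (f : Category._⇒_ C A Cc) (g : Category._⇒_ C B Cc) : Set (o ⊔ ℓ ⊔ e) where
  open Category C
  field
    commute   : f ∘ p₁ ≈ g ∘ p₂
    universal : ∀ {Z} (h₁ : Z ⇒ A) (h₂ : Z ⇒ B) → f ∘ h₁ ≈ g ∘ h₂ →
                Σ[ u ∈ Z ⇒ P ] (p₁ ∘ u ≈ h₁ × p₂ ∘ u ≈ h₂ ×
                  (∀ (v : Z ⇒ P) → p₁ ∘ v ≈ h₁ → p₂ ∘ v ≈ h₂ → v ≈ u))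

record CoproductAssumption {o ℓ e} (C : Category o ℓ e) (cp : Coproducts C)
    : Set (o ⊔ ℓ ⊔ e) where
  open Category C
  open Coproducts cp
  field
    pullback-E  : ∀ {X Y A B} (f : X ⇒ A) (g : Y ⇒ B) →
                  IsPullback C (id +₁ g) (f +₁ id) (f +₁ id) (id +₁ g)
    pullback-K  : ∀ {X Y A} (f : X ⇒ A) →
                  IsPullback C (κ₁ {X} {Y}) f (f +₁ id) κ₁
    pullback-K+ : ∀ {X Y A B} (f : X ⇒ A) (g : Y ⇒ B) →
                  IsPullback C (κ₁ {X} {Y}) f (f +₁ g) κ₁
    jointly-monic : ∀ {X Z} (h k : Z ⇒ (X + X) + X) →
                  [ id , κ₂ ] ∘ h ≈ [ id , κ₂ ] ∘ k →
                  [ [ κ₂ , κ₁ ] , κ₂ ] ∘ h ≈ [ [ κ₂ , κ₁ ] , κ₂ ] ∘ k →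
                  h ≈ k
    pullback-D  : ∀ {X Y} (f : X ⇒ Y) →
                  IsPullback C (f +₁ f) ∇ ∇ f
    pullback-D+ : ∀ {X Y} (f : X ⇒ Y) →
                  IsPullback C ((f +₁ f) +₁ f) (∇ +₁ id) (∇ +₁ id) (f +₁ f)

-- Effect algebras and effect monoids (with setoid equality and a
-- proof-relevant orthogonality relation; the partial sum x ⊕ y is only
-- defined given a witness of x ⊥ y)

record IsEffectAlgebra {a r s : Level} (A : Set a) (_≈_ : A → A → Set r)
    (_⊥_ : A → A → Set s) (⊕ : ∀ {x y} → x ⊥ y → A)
    (𝟘 𝟙 : A) (_⁻ : A → A) : Set (a ⊔ r ⊔ s) where
  field
    isEquivalence : IsEquivalence _≈_
    ⊥-resp  : ∀ {x x' y y'} → x ≈ x' → y ≈ y' → x ⊥ y → x' ⊥ y'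
    ⊕-resp  : ∀ {x x' y y'} (d : x ⊥ y) (d' : x' ⊥ y') →
              x ≈ x' → y ≈ y' → ⊕ d ≈ ⊕ d'
    ⁻-resp  : ∀ {x x'} → x ≈ x' → (x ⁻) ≈ (x' ⁻)
    ⊥-sym   : ∀ {x y} → x ⊥ y → y ⊥ x
    ⊕-comm  : ∀ {x y} (d : x ⊥ y) → ⊕ d ≈ ⊕ (⊥-sym d)
    ⊕-assoc : ∀ {x y z} (d : x ⊥ y) (d' : ⊕ d ⊥ z) →
              Σ[ e ∈ y ⊥ z ] Σ[ e' ∈ x ⊥ ⊕ e ] (⊕ d' ≈ ⊕ e')
    ⁻-⊥     : ∀ x → x ⊥ (x ⁻)
    ⁻-⊕     : ∀ x → ⊕ (⁻-⊥ x) ≈ 𝟙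
    ⁻-unique : ∀ {x y} (d : x ⊥ y) → ⊕ d ≈ 𝟙 → y ≈ (x ⁻)
    zero-one : ∀ {x} → x ⊥ 𝟙 → x ≈ 𝟘
    𝟘-def   : 𝟘 ≈ (𝟙 ⁻)

record IsEffectMonoid {a r s : Level} (A : Set a) (_≈_ : A → A → Set r)
    (_⊥_ : A → A → Set s) (⊕ : ∀ {x y} → x ⊥ y → A)
    (𝟘 𝟙 : A) (_⁻ : A → A) (_·_ : A → A → A) : Set (a ⊔ r ⊔ s) where
  field
    isEffectAlgebra : IsEffectAlgebra A _≈_ _⊥_ ⊕ 𝟘 𝟙 _⁻
    ·-resp   : ∀ {x x' y y'} → x ≈ x' → y ≈ y' → (x · y) ≈ (x' · y')
    ·-assoc  : ∀ x y z → ((x · y) · z) ≈ (x · (y · z))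
    ·-identityˡ : ∀ x → (𝟙 · x) ≈ x
    ·-identityʳ : ∀ x → (x · 𝟙) ≈ x
    ·-⊥ˡ     : ∀ x {y z} → y ⊥ z → (x · y) ⊥ (x · z)
    ·-⊕ˡ     : ∀ x {y z} (d : y ⊥ z) → (x · ⊕ d) ≈ ⊕ (·-⊥ˡ x d)
    ·-⊥ʳ     : ∀ x {y z} → y ⊥ z → (y · x) ⊥ (z · x)
    ·-⊕ʳ     : ∀ x {y z} (d : y ⊥ z) → (⊕ d · x) ≈ ⊕ (·-⊥ʳ x d)

record IsEMonHom {a r s b t u : Level}
    {A : Set a} (_≈A_ : A → A → Set r) (_⊥A_ : A → A → Set s)
    (⊕A : ∀ {x y} → x ⊥A y → A) (𝟙A : A) (_·A_ : A → A → A)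
    {B : Set b} (_≈B_ : B → B → Set t) (_⊥B_ : B → B → Set u)
    (⊕B : ∀ {x y} → x ⊥B y → B) (𝟙B : B) (_·B_ : B → B → B)
    (h : A → B) : Set (a ⊔ r ⊔ s ⊔ t ⊔ u) where
  field
    h-resp : ∀ {x y} → x ≈A y → h x ≈B h y
    h-𝟙    : h 𝟙A ≈B 𝟙B
    h-⊥    : ∀ {x y} → x ⊥A y → h x ⊥B h y
    h-⊕    : ∀ {x y} (d : x ⊥A y) → h (⊕A d) ≈B ⊕B (h-⊥ d)
    h-·    : ∀ x y → h (x ·A y) ≈B (h x ·B h y)

module PredOps {o ℓ e} (C : Category o ℓ e) (cp : Coproducts C) where
  open Category C
  open Coproducts cp

  private
    module R {A B : Obj} = SetoidR (hom-setoid A B)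
    module E {A B : Obj} = IsEquivalence (equiv {A} {B})

    ∘-distrib : ∀ {A B Z W} {f : A ⇒ Z} {g : B ⇒ Z} {h : Z ⇒ W} →
                h ∘ [ f , g ] ≈ [ h ∘ f , h ∘ g ]
    ∘-distrib {f = f} {g} {h} = unique
      (E.trans assoc (∘-resp-≈ E.refl inject₁))
      (E.trans assoc (∘-resp-≈ E.refl inject₂))

    []-cong : ∀ {A B Z} {f f' : A ⇒ Z} {g g' : B ⇒ Z} →
              f ≈ f' → g ≈ g' → [ f , g ] ≈ [ f' , g' ]
    []-cong p q = unique (E.trans inject₁ p) (E.trans inject₂ q)

    ∇κ₁ : ∀ {A} → ∇ {A} ∘ κ₁ ≈ id
    ∇κ₁ = inject₁

    ∇κ₂ : ∀ {A} → ∇ {A} ∘ κ₂ ≈ id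
    ∇κ₂ = inject₂

    transport : ∀ {X Z} {k : Z ⇒ X + X} {h : X ⇒ Z} {m : Z ⇒ X} →
                ∇ ∘ k ≈ m → m ∘ h ≈ id → ∇ ∘ (k ∘ h) ≈ id
    transport p q = E.trans (E.sym assoc) (E.trans (∘-resp-≈ p E.refl) q)

  record Pred (X : Obj) : Set (ℓ ⊔ e) where
    constructor pred
    field
      pr   : X ⇒ X + X
      pr-∇ : ∇ ∘ pr ≈ id
  open Pred public

  infix 4 _≈P_
  _≈P_ : ∀ {X} → Pred X → Pred X → Set e
  p ≈P q = pr p ≈ pr q

  𝟙P : ∀ {X} → Pred X
  𝟙P = pred κ₁ ∇κ₁

  𝟘P : ∀ {X} → Pred X
  𝟘P = pred κ₂ ∇κ₂

  _⁻P : ∀ {X} → Pred X → Pred X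
  p ⁻P = pred ([ κ₂ , κ₁ ] ∘ pr p)
    (transport (E.trans ∘-distrib ([]-cong ∇κ₂ ∇κ₁)) (pr-∇ p))

  Bound : ∀ {X} → Pred X → Pred X → Set (ℓ ⊔ e)
  Bound {X} p q = Σ[ b ∈ X ⇒ (X + X) + X ]
    ([ id , κ₂ ] ∘ b ≈ pr p × [ [ κ₂ , κ₁ ] , κ₂ ] ∘ b ≈ pr q)

  ⊞P : ∀ {X} {p q : Pred X} → Bound p q → Pred X
  ⊞P {X} {p} (b , bp , _) = pred ((∇ +₁ id) ∘ b)
    (transport key (E.trans assoc (E.trans (∘-resp-≈ E.refl bp) (pr-∇ p))))
    where
      l1 : ∇ ∘ (∇ +₁ id) ≈ [ ∇ , id ]
      l1 = E.trans ∘-distrib ([]-cong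
             (E.trans (E.sym assoc) (E.trans (∘-resp-≈ ∇κ₁ E.refl) identityˡ))
             (E.trans (E.sym assoc) (E.trans (∘-resp-≈ ∇κ₂ E.refl) identityˡ)))
      l2 : ∇ ∘ [ id , κ₂ ] ≈ [ ∇ , id ]
      l2 = E.trans ∘-distrib ([]-cong identityʳ ∇κ₂)
      key : ∇ ∘ (∇ +₁ id) ≈ ∇ ∘ [ id , κ₂ ]
      key = E.trans l1 (E.sym l2)

  _·P_ : ∀ {X} → Pred X → Pred X → Pred X
  p ·P q = pred ([ pr p , κ₂ ] ∘ pr q)
    (transport (E.trans ∘-distrib ([]-cong (pr-∇ p) ∇κ₂)) (pr-∇ q))

  -- Pred(X) as (data of) an effect monoid, and substitution f^*
  -- characterised by  ∇ ∘ f^*(q) = id  and  (f+f) ∘ f^*(q) = q ∘ f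
  record PredIndexedEMon : Set (o ⊔ ℓ ⊔ e) where
    field
      isEffectMonoid : ∀ X →
        IsEffectMonoid (Pred X) (_≈P_ {X}) (Bound {X}) (λ {p} {q} → ⊞P {X} {p} {q}) (𝟘P {X}) (𝟙P {X}) (_⁻P {X}) (_·P_ {X})
      subst     : ∀ {X Y} → X ⇒ Y → Pred Y → Pred X
      subst-def : ∀ {X Y} (f : X ⇒ Y) (q : Pred Y) →
                  (f +₁ f) ∘ pr (subst f q) ≈ pr q ∘ f
      subst-hom : ∀ {X Y} (f : X ⇒ Y) →
        IsEMonHom {A = Pred Y} (_≈P_ {Y}) (Bound {Y}) (λ {p} {q} → ⊞P {Y} {p} {q}) (𝟙P {Y}) (_·P_ {Y})
                  {B = Pred X} (_≈P_ {X}) (Bound {X}) (λ {p} {q} → ⊞P {X} {p} {q}) (𝟙P {X}) (_·P_ {X}) (subst f)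
      subst-resp : ∀ {X Y} {f g : X ⇒ Y} (q : Pred Y) → f ≈ g →
                   subst f q ≈P subst g q
      subst-id   : ∀ {X} (q : Pred X) → subst id q ≈P q
      subst-∘    : ∀ {X Y Z} (f : X ⇒ Y) (g : Y ⇒ Z) (q : Pred Z) →
                   subst (g ∘ f) q ≈P subst f (subst g q)

-- Almost every equation in the argument is an identity between "structural"
-- maps of iterated coproducts X + ... + X (built from identities,
-- coprojections and copairings), possibly composed with given maps.  Rather
-- than proving each such identity by hand, we reify structural maps as terms
-- (Str), interpret them in C, and prove a coherence theorem: two structural
-- maps are equal as soon as they act equally on summands, which is decided
-- by computation.
--
-- With this calculus the effect-algebra axioms reduce to the pullbacks of the
-- coproduct assumption: (E) glues bounds for associativity, (K+) gives the
-- orthosupplement and zero-one laws, joint monicity gives well-definedness of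
-- ⊞; the monoid laws are direct.  Substitution is defined by the pullback (D),
-- preserves bounds by (D+), and its functoriality follows from the fact that
-- f*(q) is characterised by the equation (f + f) ∘ f*(q) = q ∘ f.
module Submission where

open import Data.Empty using (⊥)
open import Data.Unit using (⊤)
open import Data.Product using (Σ-syntax; _×_; _,_; proj₁; proj₂)
open import Relation.Binary.PropositionalEquality using (_≡_; refl; cong)
open import Relation.Binary.Structures using (IsEquivalence)
open import Defs

-- Binary trees, naming iterated coproducts X + ... + X, and their leaves.
data Shape : Set where
  leaf : Shape
  _⊕_  : Shape → Shape → Shape

data Leaf : Shape → Set where
  here  : Leaf leaf
  left  : ∀ {A B} → Leaf A → Leaf (A ⊕ B)
  right : ∀ {A B} → Leaf B → Leaf (A ⊕ B)

infixr 9 _∘ˢ_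
data Str : Shape → Shape → Set where
  idˢ    : ∀ {S} → Str S S
  κ₁ˢ    : ∀ {A B} → Str A (A ⊕ B)
  κ₂ˢ    : ∀ {A B} → Str B (A ⊕ B)
  [_,_]ˢ : ∀ {A B T} → Str A T → Str B T → Str (A ⊕ B) T
  _∘ˢ_   : ∀ {S T U} → Str T U → Str S T → Str S U

∇ˢ : ∀ {A} → Str (A ⊕ A) A
∇ˢ = [ idˢ , idˢ ]ˢ

infixr 7 _+ˢ_
_+ˢ_ : ∀ {A B A′ B′} → Str A A′ → Str B B′ → Str (A ⊕ B) (A′ ⊕ B′)
s +ˢ t = [ κ₁ˢ ∘ˢ s , κ₂ˢ ∘ˢ t ]ˢ

[_,_]ᴸ : ∀ {A B T} → (Leaf A → Leaf T) → (Leaf B → Leaf T) → Leaf (A ⊕ B) → Leaf T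
[ φ , ψ ]ᴸ (left l)  = φ l
[ φ , ψ ]ᴸ (right l) = ψ l

⟪_⟫ : ∀ {S T} → Str S T → Leaf S → Leaf T
⟪ idˢ ⟫        l = l
⟪ κ₁ˢ ⟫        l = left l
⟪ κ₂ˢ ⟫        l = right l
⟪ [ s , t ]ˢ ⟫ l = [ ⟪ s ⟫ , ⟪ t ⟫ ]ᴸ l
⟪ s ∘ˢ t ⟫     l = ⟪ s ⟫ (⟪ t ⟫ l)

Same : ∀ {T} → Leaf T → Leaf T → Set
Same here      here       = ⊤
Same (left l)  (left l′)  = Same l l′
Same (right l) (right l′) = Same l l′
Same _         _          = ⊥

Same-sound : ∀ {T} (l l′ : Leaf T) → Same l l′ → l ≡ l′
Same-sound here      here       _ = refl
Same-sound (left l)  (left l′)  p = cong left (Same-sound l l′ p)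
Same-sound (right l) (right l′) p = cong right (Same-sound l l′ p)

Agree : ∀ {S T} → (Leaf S → Leaf T) → (Leaf S → Leaf T) → Set
Agree {leaf}  φ ψ = Same (φ here) (ψ here)
Agree {A ⊕ B} φ ψ = Agree (λ l → φ (left l)) (λ l → ψ (left l))
                  × Agree (λ l → φ (right l)) (λ l → ψ (right l))

Agree-sound : ∀ {S T} (φ ψ : Leaf S → Leaf T) → Agree φ ψ → (l : Leaf S) → φ l ≡ ψ l
Agree-sound φ ψ p here      = Same-sound (φ here) (ψ here) p
Agree-sound φ ψ p (left l)  = Agree-sound _ _ (proj₁ p) l
Agree-sound φ ψ p (right l) = Agree-sound _ _ (proj₂ p) l

module CoproductCalculus {o ℓ e} (C : Category o ℓ e) (cp : Coproducts C) where
  open Category C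
  open Coproducts cp

  open module ≈ {A B : Obj} = IsEquivalence (equiv {A} {B}) public
    using () renaming (refl to ≈-refl; sym to ≈-sym; trans to ≈-trans)

  infixr 5 _⊙_
  _⊙_ : ∀ {A B} {f g h : A ⇒ B} → f ≈ g → g ≈ h → f ≈ h
  _⊙_ = ≈-trans

  refl⟩∘⟨_ : ∀ {A B Z} {g : B ⇒ Z} {f f′ : A ⇒ B} → f ≈ f′ → g ∘ f ≈ g ∘ f′
  refl⟩∘⟨ p = ∘-resp-≈ ≈-refl p

  _⟩∘⟨refl : ∀ {A B Z} {g g′ : B ⇒ Z} {f : A ⇒ B} → g ≈ g′ → g ∘ f ≈ g′ ∘ f
  p ⟩∘⟨refl = ∘-resp-≈ p ≈-refl

  pullˡ : ∀ {A B D Z} {g : B ⇒ Z} {f : A ⇒ B} {h : A ⇒ Z} {k : D ⇒ A} →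
          g ∘ f ≈ h → g ∘ (f ∘ k) ≈ h ∘ k
  pullˡ p = ≈-sym assoc ⊙ p ⟩∘⟨refl

  reroute : ∀ {A B B′ D Z} {g : B ⇒ Z} {f : A ⇒ B} {g′ : B′ ⇒ Z} {f′ : A ⇒ B′} {k : D ⇒ A} →
            g ∘ f ≈ g′ ∘ f′ → g ∘ (f ∘ k) ≈ g′ ∘ (f′ ∘ k)
  reroute p = pullˡ p ⊙ assoc

  ∘-[] : ∀ {A B Z W} {f : A ⇒ Z} {g : B ⇒ Z} {h : Z ⇒ W} →
         h ∘ [ f , g ] ≈ [ h ∘ f , h ∘ g ]
  ∘-[] = unique (assoc ⊙ refl⟩∘⟨ inject₁) (assoc ⊙ refl⟩∘⟨ inject₂)

  []-cong : ∀ {A B Z} {f f′ : A ⇒ Z} {g g′ : B ⇒ Z} →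
            f ≈ f′ → g ≈ g′ → [ f , g ] ≈ [ f′ , g′ ]
  []-cong p q = unique (inject₁ ⊙ p) (inject₂ ⊙ q)

  +-η : ∀ {A B} → [ κ₁ {A} {B} , κ₂ ] ≈ id
  +-η = ≈-sym (unique identityˡ identityˡ)

  +-ext : ∀ {A B Z} {h k : A + B ⇒ Z} → h ∘ κ₁ ≈ k ∘ κ₁ → h ∘ κ₂ ≈ k ∘ κ₂ → h ≈ k
  +-ext p q = unique p q ⊙ ≈-sym (unique ≈-refl ≈-refl)

  []∘+₁ : ∀ {A B A′ B′ Z} {a : A′ ⇒ Z} {b : B′ ⇒ Z} {f : A ⇒ A′} {g : B ⇒ B′} →
          [ a , b ] ∘ (f +₁ g) ≈ [ a ∘ f , b ∘ g ]
  []∘+₁ = ∘-[] ⊙ []-cong (pullˡ inject₁) (pullˡ inject₂)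

  +₁-cong : ∀ {A B A′ B′} {f f′ : A ⇒ A′} {g g′ : B ⇒ B′} →
            f ≈ f′ → g ≈ g′ → f +₁ g ≈ f′ +₁ g′
  +₁-cong p q = []-cong (refl⟩∘⟨ p) (refl⟩∘⟨ q)

  +₁-∘ : ∀ {A B A′ B′ A″ B″} {f : A ⇒ A′} {g : B ⇒ B′} {f′ : A′ ⇒ A″} {g′ : B′ ⇒ B″} →
         (f′ ∘ f) +₁ (g′ ∘ g) ≈ (f′ +₁ g′) ∘ (f +₁ g)
  +₁-∘ = ≈-sym ([]∘+₁ ⊙ []-cong assoc assoc)

  +₁-id : ∀ {A B} → id {A} +₁ id {B} ≈ id
  +₁-id = []-cong identityʳ identityʳ ⊙ +-η

  module _ {P A B Q : Obj} {p₁ : P ⇒ A} {p₂ : P ⇒ B} {f : A ⇒ Q} {g : B ⇒ Q}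
           (pb : IsPullback C p₁ p₂ f g) {Z : Obj} {h₁ : Z ⇒ A} {h₂ : Z ⇒ B}
           (commutes : f ∘ h₁ ≈ g ∘ h₂) where
    mediator : Z ⇒ P
    mediator = proj₁ (IsPullback.universal pb h₁ h₂ commutes)

    mediator-p₁ : p₁ ∘ mediator ≈ h₁
    mediator-p₁ = proj₁ (proj₂ (IsPullback.universal pb h₁ h₂ commutes))

    mediator-p₂ : p₂ ∘ mediator ≈ h₂
    mediator-p₂ = proj₁ (proj₂ (proj₂ (IsPullback.universal pb h₁ h₂ commutes)))

    mediator-unique : ∀ (v : Z ⇒ P) → p₁ ∘ v ≈ h₁ → p₂ ∘ v ≈ h₂ → v ≈ mediator
    mediator-unique = proj₂ (proj₂ (proj₂ (IsPullback.universal pb h₁ h₂ commutes)))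

  ob : Obj → Shape → Obj
  ob X leaf    = X
  ob X (A ⊕ B) = ob X A + ob X B

  module Iterated (X : Obj) where
    inj : ∀ {S} → Leaf S → X ⇒ ob X S
    inj here      = id
    inj (left l)  = κ₁ ∘ inj l
    inj (right l) = κ₂ ∘ inj l

    leaf-ext : ∀ {S Z} {h k : ob X S ⇒ Z} → ((l : Leaf S) → h ∘ inj l ≈ k ∘ inj l) → h ≈ k
    leaf-ext {leaf} p = ≈-sym identityʳ ⊙ p here ⊙ identityʳ
    leaf-ext {A ⊕ B} p = +-ext
      (leaf-ext λ l → assoc ⊙ p (left l) ⊙ ≈-sym assoc)
      (leaf-ext λ l → assoc ⊙ p (right l) ⊙ ≈-sym assoc)

    ⟦_⟧ : ∀ {S T} → Str S T → ob X S ⇒ ob X T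
    ⟦ idˢ ⟧         = id
    ⟦ κ₁ˢ ⟧         = κ₁
    ⟦ κ₂ˢ ⟧         = κ₂
    ⟦ [ s , t ]ˢ ⟧  = [ ⟦ s ⟧ , ⟦ t ⟧ ]
    ⟦ s ∘ˢ t ⟧      = ⟦ s ⟧ ∘ ⟦ t ⟧

    ⟦⟧-inj : ∀ {S T} (t : Str S T) (l : Leaf S) → ⟦ t ⟧ ∘ inj l ≈ inj (⟪ t ⟫ l)
    ⟦⟧-inj idˢ l = identityˡ
    ⟦⟧-inj κ₁ˢ l = ≈-refl
    ⟦⟧-inj κ₂ˢ l = ≈-refl
    ⟦⟧-inj [ s , t ]ˢ (left l)  = pullˡ inject₁ ⊙ ⟦⟧-inj s l
    ⟦⟧-inj [ s , t ]ˢ (right l) = pullˡ inject₂ ⊙ ⟦⟧-inj t l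
    ⟦⟧-inj (s ∘ˢ t) l = assoc ⊙ refl⟩∘⟨ ⟦⟧-inj t l ⊙ ⟦⟧-inj s (⟪ t ⟫ l)

    -- Coherence: structural maps with the same action on leaves are equal.
    -- For closed terms the hypothesis computes to a tuple of units, so it is
    -- discharged by writing  _ .
    structural : ∀ {S T} (s t : Str S T) → Agree ⟪ s ⟫ ⟪ t ⟫ → ⟦ s ⟧ ≈ ⟦ t ⟧
    structural {S} s t p = leaf-ext λ (l : Leaf S) →
      ⟦⟧-inj s l ⊙ ≡⇒≈ (cong inj (Agree-sound ⟪ s ⟫ ⟪ t ⟫ p l)) ⊙ ≈-sym (⟦⟧-inj t l)
      where
        ≡⇒≈ : ∀ {A B} {f g : A ⇒ B} → f ≡ g → f ≈ g
        ≡⇒≈ refl = ≈-refl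

  fmap : ∀ {X Y} (f : X ⇒ Y) (S : Shape) → ob X S ⇒ ob Y S
  fmap f leaf    = f
  fmap f (A ⊕ B) = fmap f A +₁ fmap f B

  module _ {X Y : Obj} (f : X ⇒ Y) where
    private
      module IX = Iterated X
      module IY = Iterated Y

    fmap-inj : ∀ {S} (l : Leaf S) → fmap f S ∘ IX.inj l ≈ IY.inj l ∘ f
    fmap-inj here      = identityʳ ⊙ ≈-sym identityˡ
    fmap-inj (left l)  = pullˡ inject₁ ⊙ assoc ⊙ refl⟩∘⟨ fmap-inj l ⊙ ≈-sym assoc
    fmap-inj (right l) = pullˡ inject₂ ⊙ assoc ⊙ refl⟩∘⟨ fmap-inj l ⊙ ≈-sym assoc

    natural : ∀ {S T} (t : Str S T) → IY.⟦ t ⟧ ∘ fmap f S ≈ fmap f T ∘ IX.⟦ t ⟧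
    natural {S} t = IX.leaf-ext λ (l : Leaf S) →
      assoc ⊙ refl⟩∘⟨ fmap-inj l ⊙ pullˡ (IY.⟦⟧-inj t l)
      ⊙ ≈-sym (assoc ⊙ refl⟩∘⟨ IX.⟦⟧-inj t l ⊙ fmap-inj (⟪ t ⟫ l))

-- The four shapes occurring in the proof: X + X carries predicates,
-- (X + X) + X carries bounds, and the other two arise in associativity.
S2 S3 S3′ S4 : Shape
S2  = leaf ⊕ leaf
S3  = S2 ⊕ leaf
S3′ = leaf ⊕ S2
S4  = S2 ⊕ S2

-- A bound b of (p , q) has  fst ∘ b = p,  snd ∘ b = q  and  sum ∘ b = p ⊞ q.
fstˢ sndˢ sumˢ : Str S3 S2
fstˢ = [ idˢ , κ₂ˢ ]ˢ
sndˢ = [ [ κ₂ˢ , κ₁ˢ ]ˢ , κ₂ˢ ]ˢ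
sumˢ = ∇ˢ +ˢ idˢ

-- exchanging the first two summands turns a bound of (p , q) into one of (q , p)
swapˢ : Str S3 S3
swapˢ = [ κ₂ˢ , κ₁ˢ ]ˢ +ˢ idˢ

-- the associativity isomorphism (X + X) + X ≅ X + (X + X), and the
-- projections of a bound transported along it:  fst = fst′ ∘ reassoc  etc.
reassocˢ : Str S3 S3′
reassocˢ = [ [ κ₁ˢ , κ₂ˢ ∘ˢ κ₁ˢ ]ˢ , κ₂ˢ ∘ˢ κ₂ˢ ]ˢ

fst′ˢ snd′ˢ sum′ˢ : Str S3′ S2
fst′ˢ = idˢ +ˢ ∇ˢ
snd′ˢ = [ κ₂ˢ , [ κ₁ˢ , κ₂ˢ ]ˢ ]ˢ
sum′ˢ = [ κ₁ˢ , idˢ ]ˢ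

-- From a four-part splitting (x , y , z , rest): bounds of (y , z) and of (x , y ⊞ z).
yzˢ x-yzˢ : Str S4 S3
yzˢ   = [ [ κ₂ˢ , κ₁ˢ ∘ˢ κ₁ˢ ]ˢ , [ κ₁ˢ ∘ˢ κ₂ˢ , κ₂ˢ ]ˢ ]ˢ
x-yzˢ = [ κ₁ˢ , [ κ₁ˢ ∘ˢ κ₂ˢ , κ₂ˢ ]ˢ ]ˢ

-- Refining along a predicate x sends its two outcomes to the given summand
-- resp. to the last one; used to turn a bound of (y , z) into one of (x·y , x·z).
refine₁ˢ refine₂ˢ : Str S2 S3
refine₁ˢ = [ κ₁ˢ ∘ˢ κ₁ˢ , κ₂ˢ ]ˢ
refine₂ˢ = [ κ₁ˢ ∘ˢ κ₂ˢ , κ₂ˢ ]ˢ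

module PredicateTheory {o ℓ e} (C : Category o ℓ e) (cp : Coproducts C)
                       (ca : CoproductAssumption C cp) where
  open Category C
  open Coproducts cp
  open CoproductAssumption ca
  open CoproductCalculus C cp
  open PredOps C cp

  -- the partial sum, with the summands made explicit (they cannot be
  -- recovered from the type of the bound)
  ⊞[_,_] : ∀ {X} (x y : Pred X) → Bound x y → Pred X
  ⊞[ x , y ] d = ⊞P {p = x} {q = y} d

  module EffectMonoidOn (X : Obj) where
    open Iterated X

    -- a structural map on X + X that does not distinguish the two outcomes
    -- of a predicate absorbs it, since ∇ ∘ pr x ≈ id
    forget : ∀ {T} (x : Pred X) (s : Str S2 T) (t : Str leaf T) →
             Agree ⟪ s ⟫ ⟪ t ∘ˢ ∇ˢ ⟫ → ⟦ s ⟧ ∘ pr x ≈ ⟦ t ⟧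
    forget x s t agree =
      structural s (t ∘ˢ ∇ˢ) agree ⟩∘⟨refl ⊙ assoc ⊙ refl⟩∘⟨ pr-∇ x ⊙ identityʳ

    keep : (x : Pred X) (s : Str S2 S2) → Agree ⟪ s ⟫ ⟪ idˢ ⟫ → ⟦ s ⟧ ∘ pr x ≈ pr x
    keep x s agree = structural s idˢ agree ⟩∘⟨refl ⊙ identityˡ

    ⊥-sym′ : ∀ {x y : Pred X} → Bound x y → Bound y x
    ⊥-sym′ (b , b₁ , b₂) =
      ⟦ swapˢ ⟧ ∘ b ,
      pullˡ (structural (fstˢ ∘ˢ swapˢ) sndˢ _) ⊙ b₂ ,
      pullˡ (structural (sndˢ ∘ˢ swapˢ) fstˢ _) ⊙ b₁

    ⊕-comm′ : ∀ {x y : Pred X} (d : Bound x y) → ⊞[ x , y ] d ≈P ⊞[ y , x ] (⊥-sym′ {x} {y} d)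
    ⊕-comm′ _ = ≈-sym (pullˡ (structural (sumˢ ∘ˢ swapˢ) sumˢ _))

    -- A bound b of (x , y) and a bound c of (x ⊞ y , z) agree on x ⊞ y, so by
    -- the pullback (E) they glue to a splitting w of X into (x , y , z , rest),
    -- from which the bounds of (y , z) and of (x , y ⊞ z) are read off.
    ⊕-assoc′ : ∀ {x y z : Pred X} (d : Bound x y) (d′ : Bound (⊞[ x , y ] d) z) →
               Σ[ e ∈ Bound y z ] Σ[ e′ ∈ Bound x (⊞[ y , z ] e) ]
                 (⊞[ ⊞[ x , y ] d , z ] d′ ≈P ⊞[ x , ⊞[ y , z ] e ] e′)
    ⊕-assoc′ {x} {y} {z} (b , b₁ , b₂) (c , c₁ , c₂) =
      (⟦ yzˢ ⟧ ∘ w , w-y , w-z) , (⟦ x-yzˢ ⟧ ∘ w , w-x , w-y⊞z) , sums-agree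
      where
        glue : (∇ +₁ id) ∘ b ≈ (id +₁ ∇) ∘ (⟦ reassocˢ ⟧ ∘ c)
        glue = ≈-sym c₁ ⊙ ≈-sym (pullˡ (structural (fst′ˢ ∘ˢ reassocˢ) fstˢ _))

        w : X ⇒ (X + X) + (X + X)
        w = mediator (pullback-E ∇ ∇) glue

        w-b : (id +₁ ∇) ∘ w ≈ b
        w-b = mediator-p₁ (pullback-E ∇ ∇) glue

        w-c : (∇ +₁ id) ∘ w ≈ ⟦ reassocˢ ⟧ ∘ c
        w-c = mediator-p₂ (pullback-E ∇ ∇) glue

        w-x : [ id , κ₂ ] ∘ (⟦ x-yzˢ ⟧ ∘ w) ≈ pr x
        w-x = reroute (structural (fstˢ ∘ˢ x-yzˢ) (fstˢ ∘ˢ (idˢ +ˢ ∇ˢ)) _) ⊙ refl⟩∘⟨ w-b ⊙ b₁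

        w-y : [ id , κ₂ ] ∘ (⟦ yzˢ ⟧ ∘ w) ≈ pr y
        w-y = reroute (structural (fstˢ ∘ˢ yzˢ) (sndˢ ∘ˢ (idˢ +ˢ ∇ˢ)) _) ⊙ refl⟩∘⟨ w-b ⊙ b₂

        w-z : [ [ κ₂ , κ₁ ] , κ₂ ] ∘ (⟦ yzˢ ⟧ ∘ w) ≈ pr z
        w-z = reroute (structural (sndˢ ∘ˢ yzˢ) (snd′ˢ ∘ˢ (∇ˢ +ˢ idˢ)) _) ⊙ refl⟩∘⟨ w-c
            ⊙ pullˡ (structural (snd′ˢ ∘ˢ reassocˢ) sndˢ _) ⊙ c₂

        w-y⊞z : [ [ κ₂ , κ₁ ] , κ₂ ] ∘ (⟦ x-yzˢ ⟧ ∘ w) ≈ (∇ +₁ id) ∘ (⟦ yzˢ ⟧ ∘ w)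
        w-y⊞z = reroute (structural (sndˢ ∘ˢ x-yzˢ) (sumˢ ∘ˢ yzˢ) _)

        sums-agree : (∇ +₁ id) ∘ c ≈ (∇ +₁ id) ∘ (⟦ x-yzˢ ⟧ ∘ w)
        sums-agree = ≈-sym (pullˡ (structural (sum′ˢ ∘ˢ reassocˢ) sumˢ _))
                   ⊙ refl⟩∘⟨ ≈-sym w-c
                   ⊙ reroute (structural (sum′ˢ ∘ˢ (∇ˢ +ˢ idˢ)) (sumˢ ∘ˢ x-yzˢ) _)

    ⁻-⊥′ : ∀ (x : Pred X) → Bound x (x ⁻P)
    ⁻-⊥′ x = κ₁ ∘ pr x , pullˡ inject₁ ⊙ identityˡ , pullˡ inject₁

    ⁻-⊕′ : ∀ (x : Pred X) → ⊞[ x , x ⁻P ] (⁻-⊥′ x) ≈P 𝟙P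
    ⁻-⊕′ x = pullˡ inject₁ ⊙ assoc ⊙ refl⟩∘⟨ pr-∇ x ⊙ identityʳ

    -- If x ⊞ y = 1 then, by (K+), the bound is κ₁ ∘ u with u = x; hence y = x^⊥.
    ⁻-unique′ : ∀ {x y : Pred X} (d : Bound x y) → ⊞[ x , y ] d ≈P 𝟙P → y ≈P (x ⁻P)
    ⁻-unique′ {x} (b , b₁ , b₂) sum≈𝟙 =
      ≈-sym b₂ ⊙ refl⟩∘⟨ ≈-sym κ₁u≈b ⊙ pullˡ inject₁ ⊙ refl⟩∘⟨ u≈x
      where
        cond : (∇ +₁ id) ∘ b ≈ κ₁ ∘ id
        cond = sum≈𝟙 ⊙ ≈-sym identityʳ

        u : X ⇒ X + X
        u = mediator (pullback-K+ ∇ id) cond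

        κ₁u≈b : κ₁ ∘ u ≈ b
        κ₁u≈b = mediator-p₁ (pullback-K+ ∇ id) cond

        u≈x : u ≈ pr x
        u≈x = ≈-sym (pullˡ inject₁ ⊙ identityˡ) ⊙ refl⟩∘⟨ κ₁u≈b ⊙ b₁

    -- If x ⊥ 1, the bound presented on X + (X + X) with the 1-part first is,
    -- by (K+), of the form κ₁ ∘ u with u = id; its x-part is then empty.
    zero-one′ : ∀ {x : Pred X} → Bound x 𝟙P → x ≈P 𝟘P
    zero-one′ (b , b₁ , b₂) =
      ≈-sym b₁
      ⊙ structural fstˢ (snd′ˢ ∘ˢ reassocˢ ∘ˢ swapˢ) _ ⟩∘⟨refl ⊙ assoc
      ⊙ refl⟩∘⟨ ≈-sym κ₁u≈b′ ⊙ pullˡ inject₁ ⊙ refl⟩∘⟨ u≈id ⊙ identityʳ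
      where
        b′ : X ⇒ X + (X + X)
        b′ = ⟦ reassocˢ ∘ˢ swapˢ ⟧ ∘ b

        cond : (id +₁ ∇) ∘ b′ ≈ κ₁ ∘ id
        cond = pullˡ (structural (fst′ˢ ∘ˢ reassocˢ ∘ˢ swapˢ) sndˢ _) ⊙ b₂ ⊙ ≈-sym identityʳ

        u : X ⇒ X
        u = mediator (pullback-K+ id ∇) cond

        κ₁u≈b′ : κ₁ ∘ u ≈ b′
        κ₁u≈b′ = mediator-p₁ (pullback-K+ id ∇) cond

        u≈id : u ≈ id
        u≈id = ≈-sym identityˡ ⊙ mediator-p₂ (pullback-K+ id ∇) cond

    -- ⊞ is well defined on ≈P-classes since bounds are determined by their
    -- projections (joint monicity)
    isEffectAlgebra : IsEffectAlgebra (Pred X) _≈P_ Bound (λ {x} {y} → ⊞[ x , y ]) 𝟘P 𝟙P _⁻P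
    isEffectAlgebra = record
      { isEquivalence = record { refl = ≈-refl ; sym = ≈-sym ; trans = ≈-trans }
      ; ⊥-resp   = λ px py (b , b₁ , b₂) → b , b₁ ⊙ px , b₂ ⊙ py
      ; ⊕-resp   = λ (b , b₁ , b₂) (b′ , b₁′ , b₂′) px py → refl⟩∘⟨
          jointly-monic b b′ (b₁ ⊙ px ⊙ ≈-sym b₁′) (b₂ ⊙ py ⊙ ≈-sym b₂′)
      ; ⁻-resp   = refl⟩∘⟨_
      ; ⊥-sym    = λ {x} {y} → ⊥-sym′ {x} {y}
      ; ⊕-comm   = λ {x} {y} → ⊕-comm′ {x} {y}
      ; ⊕-assoc  = λ {x} {y} {z} → ⊕-assoc′ {x} {y} {z}
      ; ⁻-⊥      = ⁻-⊥′
      ; ⁻-⊕      = ⁻-⊕′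
      ; ⁻-unique = λ {x} {y} → ⁻-unique′ {x} {y}
      ; zero-one = λ {x} → zero-one′ {x}
      ; 𝟘-def    = ≈-sym inject₁
      }

    -- A bound of (y , z) refined along x is a bound of (x·y , x·z).
    refine : Pred X → (X + X) + X ⇒ (X + X) + X
    refine x = [ [ ⟦ refine₁ˢ ⟧ ∘ pr x , ⟦ refine₂ˢ ⟧ ∘ pr x ] , κ₂ ]

    refine-after : ∀ {T} (x : Pred X) (s : Str S3 T) →
      ⟦ s ⟧ ∘ refine x ≈ [ [ ⟦ s ∘ˢ refine₁ˢ ⟧ ∘ pr x , ⟦ s ∘ˢ refine₂ˢ ⟧ ∘ pr x ] , ⟦ s ⟧ ∘ κ₂ ]
    refine-after x s = ∘-[] ⊙ []-cong (∘-[] ⊙ []-cong (≈-sym assoc) (≈-sym assoc)) ≈-refl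

    refine-fst : ∀ x → [ id , κ₂ ] ∘ refine x ≈ [ pr x , κ₂ ] ∘ [ id , κ₂ ]
    refine-fst x = refine-after x fstˢ
      ⊙ []-cong ([]-cong (keep x (fstˢ ∘ˢ refine₁ˢ) _) (forget x (fstˢ ∘ˢ refine₂ˢ) κ₂ˢ _)) inject₂
      ⊙ ≈-sym (∘-[] ⊙ []-cong identityʳ inject₂)

    refine-snd : ∀ x → [ [ κ₂ , κ₁ ] , κ₂ ] ∘ refine x ≈ [ pr x , κ₂ ] ∘ [ [ κ₂ , κ₁ ] , κ₂ ]
    refine-snd x = refine-after x sndˢ
      ⊙ []-cong ([]-cong (forget x (sndˢ ∘ˢ refine₁ˢ) κ₂ˢ _) (keep x (sndˢ ∘ˢ refine₂ˢ) _)) inject₂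
      ⊙ ≈-sym (∘-[] ⊙ []-cong (∘-[] ⊙ []-cong inject₂ inject₁) inject₂)

    refine-sum : ∀ x → (∇ +₁ id) ∘ refine x ≈ [ pr x , κ₂ ] ∘ (∇ +₁ id)
    refine-sum x = refine-after x sumˢ
      ⊙ []-cong ([]-cong (keep x (sumˢ ∘ˢ refine₁ˢ) _) (keep x (sumˢ ∘ˢ refine₂ˢ) _))
                (inject₂ ⊙ identityʳ)
      ⊙ ≈-sym ([]∘+₁ ⊙ []-cong (∘-[] ⊙ []-cong identityʳ identityʳ) identityʳ)

    ·-⊥ˡ′ : ∀ (x : Pred X) {y z : Pred X} → Bound y z → Bound (x ·P y) (x ·P z)
    ·-⊥ˡ′ x (b , b₁ , b₂) =
      refine x ∘ b , reroute (refine-fst x) ⊙ refl⟩∘⟨ b₁ , reroute (refine-snd x) ⊙ refl⟩∘⟨ b₂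

    ·-⊥ʳ′ : ∀ (x : Pred X) {y z : Pred X} → Bound y z → Bound (y ·P x) (z ·P x)
    ·-⊥ʳ′ x (b , b₁ , b₂) =
      [ b , κ₂ ] ∘ pr x ,
      pullˡ (∘-[] ⊙ []-cong b₁ inject₂) ,
      pullˡ (∘-[] ⊙ []-cong b₂ inject₂)

    isEffectMonoid : IsEffectMonoid (Pred X) _≈P_ Bound (λ {x} {y} → ⊞[ x , y ]) 𝟘P 𝟙P _⁻P _·P_
    isEffectMonoid = record
      { isEffectAlgebra = isEffectAlgebra
      ; ·-resp      = λ px py → ∘-resp-≈ ([]-cong px ≈-refl) py
      ; ·-assoc     = λ x y z → ≈-sym (∘-[] ⊙ []-cong ≈-refl inject₂) ⟩∘⟨refl ⊙ assoc
      ; ·-identityˡ = λ x → +-η ⟩∘⟨refl ⊙ identityˡ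
      ; ·-identityʳ = λ x → inject₁
      ; ·-⊥ˡ        = λ x {y} {z} → ·-⊥ˡ′ x {y} {z}
      ; ·-⊕ˡ        = λ x {y} {z} _ → ≈-sym (reroute (refine-sum x))
      ; ·-⊥ʳ        = λ x {y} {z} → ·-⊥ʳ′ x {y} {z}
      ; ·-⊕ʳ        = λ x {y} {z} _ →
          ≈-sym (∘-[] ⊙ []-cong ≈-refl (inject₂ ⊙ identityʳ)) ⟩∘⟨refl ⊙ assoc
      }

  -- Substitution f*(q) is the mediating map of the pullback (D) for the cone
  -- (q ∘ f , id); it is the unique predicate p with (f + f) ∘ p ≈ q ∘ f.
  module Substitution {X Y : Obj} (f : X ⇒ Y) where
    private
      module IX = Iterated X
      module IY = Iterated Y

      cone : (q : Pred Y) → ∇ ∘ (pr q ∘ f) ≈ f ∘ id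
      cone q = pullˡ (pr-∇ q) ⊙ identityˡ ⊙ ≈-sym identityʳ

    sub : Pred Y → Pred X
    sub q = pred (mediator (pullback-D f) (cone q)) (mediator-p₂ (pullback-D f) (cone q))

    sub-def : ∀ q → (f +₁ f) ∘ pr (sub q) ≈ pr q ∘ f
    sub-def q = mediator-p₁ (pullback-D f) (cone q)

    sub-unique : ∀ q (v : X ⇒ X + X) → (f +₁ f) ∘ v ≈ pr q ∘ f → ∇ ∘ v ≈ id → v ≈ pr (sub q)
    sub-unique q = mediator-unique (pullback-D f) (cone q)

    sub-char : ∀ (q : Pred Y) (p : Pred X) → (f +₁ f) ∘ pr p ≈ pr q ∘ f → sub q ≈P p
    sub-char q p eq = ≈-sym (sub-unique q (pr p) eq (pr-∇ p))

    -- A bound b of (p , q) lifts along f, by the pullback (D+), to a bound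
    -- of (f* p , f* q) whose sum is f*(p ⊞ q).
    module _ {p q : Pred Y} (d : Bound p q) where
      private
        b : Y ⇒ (Y + Y) + Y
        b = proj₁ d

        p⊞q : Pred Y
        p⊞q = ⊞[ p , q ] d

        cone⁺ : (∇ +₁ id) ∘ (b ∘ f) ≈ (f +₁ f) ∘ pr (sub p⊞q)
        cone⁺ = ≈-sym assoc ⊙ ≈-sym (sub-def p⊞q)

        u : X ⇒ (X + X) + X
        u = mediator (pullback-D+ f) cone⁺

        u-b : ((f +₁ f) +₁ f) ∘ u ≈ b ∘ f
        u-b = mediator-p₁ (pullback-D+ f) cone⁺

        u-sum : (∇ +₁ id) ∘ u ≈ pr (sub p⊞q)
        u-sum = mediator-p₂ (pullback-D+ f) cone⁺

        projection : (s : Str S3 S2) {r : Pred Y} → IY.⟦ s ⟧ ∘ b ≈ pr r →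
                     Agree ⟪ ∇ˢ ∘ˢ s ⟫ ⟪ ∇ˢ ∘ˢ sumˢ ⟫ → IX.⟦ s ⟧ ∘ u ≈ pr (sub r)
        projection s {r} s-b agree = sub-unique r (IX.⟦ s ⟧ ∘ u)
          (reroute (≈-sym (natural f s)) ⊙ refl⟩∘⟨ u-b ⊙ pullˡ s-b)
          (reroute (IX.structural (∇ˢ ∘ˢ s) (∇ˢ ∘ˢ sumˢ) agree)
           ⊙ refl⟩∘⟨ u-sum ⊙ pr-∇ (sub p⊞q))

      sub-⊥ : Bound (sub p) (sub q)
      sub-⊥ = u , projection fstˢ (proj₁ (proj₂ d)) _ , projection sndˢ (proj₂ (proj₂ d)) _

      sub-⊕ : sub p⊞q ≈P ⊞[ sub p , sub q ] sub-⊥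
      sub-⊕ = ≈-sym u-sum

    -- f* preserves multiplication: (f + f) commutes with [ p , κ₂ ] up to f
    sub-· : ∀ p q → sub (p ·P q) ≈P (sub p ·P sub q)
    sub-· p q = sub-char (p ·P q) (sub p ·P sub q)
      (reroute (∘-[] ⊙ []-cong (sub-def p) inject₂ ⊙ ≈-sym []∘+₁)
       ⊙ refl⟩∘⟨ sub-def q ⊙ ≈-sym assoc)

    isEMonHom : IsEMonHom _≈P_ Bound (λ {p} {q} → ⊞[ p , q ]) 𝟙P _·P_
                          _≈P_ Bound (λ {p} {q} → ⊞[ p , q ]) 𝟙P _·P_ sub
    isEMonHom = record
      { h-resp = λ {q} {q′} q≈q′ → ≈-sym (sub-char q′ (sub q) (sub-def q ⊙ q≈q′ ⟩∘⟨refl))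
      ; h-𝟙    = sub-char 𝟙P 𝟙P inject₁
      ; h-⊥    = λ {p} {q} → sub-⊥ {p} {q}
      ; h-⊕    = λ {p} {q} → sub-⊕ {p} {q}
      ; h-·    = sub-·
      }

  open Substitution using (sub; sub-def; sub-char; isEMonHom)

  sub-resp : ∀ {X Y} {f g : X ⇒ Y} (q : Pred Y) → f ≈ g → sub f q ≈P sub g q
  sub-resp {f = f} {g} q f≈g =
    sub-char f q (sub g q) (+₁-cong f≈g f≈g ⟩∘⟨refl ⊙ sub-def g q ⊙ refl⟩∘⟨ ≈-sym f≈g)

  sub-id : ∀ {X} (q : Pred X) → sub id q ≈P q
  sub-id q = sub-char id q q (+₁-id ⟩∘⟨refl ⊙ identityˡ ⊙ ≈-sym identityʳ)

  sub-∘ : ∀ {X Y Z} (f : X ⇒ Y) (g : Y ⇒ Z) (q : Pred Z) → sub (g ∘ f) q ≈P sub f (sub g q)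
  sub-∘ f g q = sub-char (g ∘ f) q (sub f (sub g q))
    (+₁-∘ ⟩∘⟨refl ⊙ assoc ⊙ refl⟩∘⟨ sub-def f (sub g q) ⊙ pullˡ (sub-def g q) ⊙ assoc)

  predIndexedEMon : PredIndexedEMon
  predIndexedEMon = record
    { isEffectMonoid = EffectMonoidOn.isEffectMonoid
    ; subst          = sub
    ; subst-def      = sub-def
    ; subst-hom      = isEMonHom
    ; subst-resp     = sub-resp
    ; subst-id       = sub-id
    ; subst-∘        = sub-∘
    }

corollary7p2 : ∀ {o ℓ e} (C : Category o ℓ e) (cp : Coproducts C) →
    CoproductAssumption C cp → PredOps.PredIndexedEMon C cp
corollary7p2 C cp ca = PredicateTheory.predIndexedEMon C cp ca
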